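{- Let $G$ be a finite directed multigraph (loops and multiple arcs allowed) and let $\phi(G)$ denote its hike dependency graph. Then: (1) If $G$ is strongly connected, then $\phi(G)$ is a connected graph. (2) If $G_1,\dots,G_n$ are the strongly connected components of $G$, then $\phi(G)=\bigsqcup_{i\in[n]}\phi(G_i)$ (disjoint union of graphs). (3) If $H$ is a connected realizable graph, then $H$ is realizable by a strongly connected directed multigraph.
   Context: A directed multigraph $G=(V,E)$ has a finite vertex set $V$ and a finite multiset $E$ of arcs $(i,j)_k$, $i,j\in V$. A simple cycle of $G$ is a closed sequence of arcs $(i_0,i_1)_{k_1}(i_1,i_2)_{k_2}\cdots(i_{\ell-1},i_0)_{k_\ell}$, $\ell\ge 1$, with all vertices $i_0,\dots,i_{\ell-1}$ distinct, considered up to cyclic rotation (the starting point is irrelevant, but orientation and the specific arcs used matter; a self-loop is a simple cycle of length one). The hike dependency graph $\phi(G)$ is the simple undirected graph whose vertices are the simple cycles of $G$, two distinct simple cycles being adjacent if and only if they share at least one vertex of $G$. A strongly connected component of $G$ is a maximal subgraph in which every vertex can reach every other vertex by a directed path. A (simple, finite, undirected) graph $H$ is realizable if there exists a directed multigraph $G$ with $\phi(G)$ isomorphic to $H$; $G$ is then said to realize $H$. -}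

module Defs where

open import Data.Nat using (ℕ)
open import Data.Fin using (Fin)
open import Data.List using (List; []; _∷_; _++_; [_]; map; drop; take)
open import Data.List.Relation.Unary.Linked using (Linked)
open import Data.List.Relation.Unary.Unique.Propositional using (Unique)
open import Data.List.Membership.Propositional using (_∈_)
open import Data.Product using (Σ; ∃; _×_; _,_; proj₁)
open import Data.Sum using (_⊎_)
open import Data.Empty using (⊥)
open import Function.Bundles using (_↔_; _⇔_)
open import Relation.Nullary using (¬_)
open import Relation.Binary.PropositionalEquality using (_≡_)
open import Relation.Binary.Construct.Closure.ReflexiveTransitive using (Star)

-- Directed multigraphs: a vertex type, an arc type (arcs are labelled,
-- so parallel arcs and loops are allowed), source and target maps.

record Multigraph : Set₁ where
  field
    V   : Set
    Arc : Set
    src : Arc → V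
    tgt : Arc → V

open Multigraph public

IsFinite : Multigraph → Set
IsFinite G = (Σ ℕ λ k → V G ↔ Fin k) × (Σ ℕ λ k → Arc G ↔ Fin k)

ArcBetween : (G : Multigraph) → V G → V G → Set
ArcBetween G u v = Σ (Arc G) λ a → (src G a ≡ u) × (tgt G a ≡ v)

Reach : (G : Multigraph) → V G → V G → Set
Reach G = Star (ArcBetween G)

StronglyConnected : Multigraph → Set
StronglyConnected G = ∀ u v → Reach G u v

-- Simple cycles, as arc sequences (a₁ … aℓ), ℓ ≥ 1, with
-- tgt aₖ = src aₖ₊₁ cyclically and all source vertices distinct.

IsSimpleCycle : (G : Multigraph) → List (Arc G) → Set
IsSimpleCycle G [] = ⊥
IsSimpleCycle G (a ∷ as) =
  Linked (λ x y → tgt G x ≡ src G y) (a ∷ as ++ [ a ])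
  × Unique (map (src G) (a ∷ as))

Rot : {A : Set} → List A → List A → Set
Rot xs ys = ∃ λ k → ys ≡ drop k xs ++ take k xs

verts : (G : Multigraph) → List (Arc G) → List (V G)
verts G as = map (src G) as

ShareVertex : (G : Multigraph) → List (Arc G) → List (Arc G) → Set
ShareVertex G c d = ∃ λ v → (v ∈ verts G c) × (v ∈ verts G d)

-- Simple undirected graphs presented on a setoid-like vertex type:
-- V, an identification relation _≈_ (which vertices are "the same"),
-- and adjacency.

record SGraph : Set₁ where
  field
    Vt  : Set
    _≈_ : Vt → Vt → Set
    Adj : Vt → Vt → Set

open SGraph public

record _≅_ (A B : SGraph) : Set where
  field
    f    : Vt A → Vt B
    resp : ∀ x y → _≈_ A x y → _≈_ B (f x) (f y)
    inj  : ∀ x y → _≈_ B (f x) (f y) → _≈_ A x y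
    surj : ∀ y → ∃ λ x → _≈_ B (f x) y
    adj  : ∀ x y → Adj A x y ⇔ Adj B (f x) (f y)

Connected : SGraph → Set
Connected A = ∀ x y → Star (λ u v → _≈_ A u v ⊎ Adj A u v) x y

module _ {n : ℕ} (A : Fin n → SGraph) where
  data ⊔≈ : Σ (Fin n) (λ i → Vt (A i)) → Σ (Fin n) (λ i → Vt (A i)) → Set where
    inj≈ : ∀ {i x y} → _≈_ (A i) x y → ⊔≈ (i , x) (i , y)

  data ⊔Adj : Σ (Fin n) (λ i → Vt (A i)) → Σ (Fin n) (λ i → Vt (A i)) → Set where
    injAdj : ∀ {i x y} → Adj (A i) x y → ⊔Adj (i , x) (i , y)

⨆ : {n : ℕ} → (Fin n → SGraph) → SGraph
⨆ {n} A = record { Vt = Σ (Fin n) (λ i → Vt (A i)) ; _≈_ = ⊔≈ A ; Adj = ⊔Adj A }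

-- The hike dependency graph φ(G): vertices are simple cycles up to
-- rotation; two distinct ones are adjacent iff they share a vertex.

SimpleCycle : Multigraph → Set
SimpleCycle G = Σ (List (Arc G)) (IsSimpleCycle G)

φ : Multigraph → SGraph
φ G = record
  { Vt  = SimpleCycle G
  ; _≈_ = λ c d → Rot (proj₁ c) (proj₁ d)
  ; Adj = λ c d → ¬ Rot (proj₁ c) (proj₁ d) × ShareVertex G (proj₁ c) (proj₁ d)
  }

-- Strongly connected components given by a labelling comp : V → Fin n:
-- every label is used, and same label ⇔ mutually reachable.

IsSCCLabelling : (G : Multigraph) (n : ℕ) → (V G → Fin n) → Set
IsSCCLabelling G n comp =
  (∀ i → ∃ λ v → comp v ≡ i)
  × (∀ u v → (comp u ≡ comp v) ⇔ (Reach G u v × Reach G v u))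

-- the i-th component: induced subgraph on comp⁻¹(i) (a maximal strongly
-- connected subgraph contains every arc between its vertices)
Component : (G : Multigraph) {n : ℕ} → (V G → Fin n) → Fin n → Multigraph
Component G comp i = record
  { V   = Σ (V G) λ v → comp v ≡ i
  ; Arc = Σ (Arc G) λ a → (comp (src G a) ≡ i) × (comp (tgt G a) ≡ i)
  ; src = λ { (a , p , q) → src G a , p }
  ; tgt = λ { (a , p , q) → tgt G a , q }
  }

record SimpleGraph : Set₁ where
  field
    size    : ℕ
    E       : Fin size → Fin size → Set
    E-sym   : ∀ i j → E i j → E j i
    E-irrefl : ∀ i → ¬ E i i

open SimpleGraph public

toSGraph : SimpleGraph → SGraph
toSGraph H = record { Vt = Fin (size H) ; _≈_ = _≡_ ; Adj = E H }

Realizes : Multigraph → SimpleGraph → Set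
Realizes G H = toSGraph H ≅ φ G

Realizable : SimpleGraph → Set₁
Realizable H = Σ Multigraph λ G → IsFinite G × Realizes G H

-- (1) In a strongly connected graph every arc lies on a simple cycle, closed by a walk back that
-- is shortcut to a simple path; the cycles through consecutive arcs of a walk share a vertex, so a walk from a vertex of
-- one simple cycle to a vertex of another yields a path between them in φ G.
-- (2) The vertices of a simple cycle are mutually reachable, so every simple cycle lies inside a
-- single strongly connected component, and cycles in different components share no vertex.
-- (3) If G realizes a connected H, delete the vertices lying on no simple cycle: this changes no
-- simple cycle, and the remaining graph is strongly connected because any two of its vertices
-- are joined through a chain of pairwise intersecting simple cycles.

module Submission where

open import Defs
open import Axiom.UniquenessOfIdentityProofs.WithK using (uip)
open import Data.Bool.Properties using (T-irrelevant)
open import Data.Empty using (⊥-elim)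
open import Data.Fin as Fin using (Fin; zero; suc)
import Data.Fin.Properties as Fin
open import Data.List using (List; []; _∷_; _++_; [_]; map; drop; take; length)
import Data.List.Properties as List
open import Data.List.Membership.Propositional using (_∈_; _∉_)
open import Data.List.Membership.Propositional.Properties using (∈-map⁺; ∈-map⁻; ∈-++⁺ˡ)
open import Data.List.Relation.Binary.Permutation.Propositional using (_↭_)
open import Data.List.Relation.Binary.Permutation.Propositional.Properties using (++-comm; ∈-resp-↭)
open import Data.List.Relation.Unary.All.Properties using (¬Any⇒All¬)
open import Data.List.Relation.Unary.AllPairs using ([]; _∷_)
open import Data.List.Relation.Unary.Any using (here; there)
import Data.List.Relation.Unary.Any as Any
open import Data.List.Relation.Unary.Linked using (Linked; []; [-]; _∷_)
import Data.List.Relation.Unary.Linked as Linked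
import Data.List.Relation.Unary.Linked.Properties as Linked
open import Data.List.Relation.Unary.Unique.Propositional using (Unique)
import Data.List.Relation.Unary.Unique.Propositional.Properties as Unique
open import Data.Nat using (ℕ; zero; suc; _≤_; _<_; s≤s; z≤n)
import Data.Nat.Properties as ℕ
open import Data.Product using (Σ; ∃; _×_; _,_; proj₁; proj₂)
open import Data.Product.Function.Dependent.Propositional using (Σ-↔)
open import Data.Sum using (_⊎_; inj₁; inj₂; [_,_]′; map₁)
open import Function using (_∘_; id)
open import Function.Bundles using (_↔_; _⇔_; Inverse; Equivalence; mk↔ₛ′; mk⇔)
open import Function.Construct.Composition using (_↔-∘_)
open import Function.Properties.Inverse using (↔⇒↣)
open import Relation.Binary.Definitions using (DecidableEquality)
open import Relation.Binary.PropositionalEquality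
  using (_≡_; refl; sym; trans; cong; cong₂; subst; subst₂)
open import Relation.Binary.Construct.Closure.ReflexiveTransitive using (Star; ε; _◅_; _◅◅_)
open import Relation.Nullary using (Dec; yes; no; Irrelevant)
open import Relation.Nullary.Decidable
  using (True; toWitness; fromWitness; via-injection; map′; T?; _×-dec_)
open import Relation.Unary using (Decidable)

-- Finite types

Finite : Set → Set
Finite A = Σ ℕ λ k → A ↔ Fin k

finite⇒≟ : {A : Set} → Finite A → DecidableEquality A
finite⇒≟ (_ , A↔Fin) = via-injection (↔⇒↣ A↔Fin) Fin._≟_

Σ-Fin-finite : ∀ {k} {P : Fin k → Set} → Decidable P → (∀ {i} → Irrelevant (P i)) →
               Finite (Σ (Fin k) P)
Σ-Fin-finite {zero} _ _ = 0 , mk↔ₛ′ (λ { (() , _) }) (λ ()) (λ ()) (λ { (() , _) })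
Σ-Fin-finite {suc k} {P} P? P-irr with Σ-Fin-finite (P? ∘ suc) P-irr | P? zero
... | m , I | yes p₀ = suc m , mk↔ₛ′ to from to∘from from∘to
  where
  module I = Inverse I
  to : Σ (Fin (suc k)) P → Fin (suc m)
  to (zero , _) = zero
  to (suc i , p) = suc (I.to (i , p))
  from : Fin (suc m) → Σ (Fin (suc k)) P
  from zero = zero , p₀
  from (suc x) = suc (proj₁ (I.from x)) , proj₂ (I.from x)
  to∘from : ∀ x → to (from x) ≡ x
  to∘from zero = refl
  to∘from (suc x) = cong suc (I.strictlyInverseˡ x)
  from∘to : ∀ y → from (to y) ≡ y
  from∘to (zero , p) = cong (zero ,_) (P-irr p₀ p)
  from∘to (suc i , p) = cong (λ (j , q) → suc j , q) (I.strictlyInverseʳ (i , p))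
... | m , I | no ¬p₀ = m , mk↔ₛ′ to from I.strictlyInverseˡ from∘to
  where
  module I = Inverse I
  to : Σ (Fin (suc k)) P → Fin m
  to (zero , p) = ⊥-elim (¬p₀ p)
  to (suc i , p) = I.to (i , p)
  from : Fin m → Σ (Fin (suc k)) P
  from x = suc (proj₁ (I.from x)) , proj₂ (I.from x)
  from∘to : ∀ y → from (to y) ≡ y
  from∘to (zero , p) = ⊥-elim (¬p₀ p)
  from∘to (suc i , p) = cong (λ (j , q) → suc j , q) (I.strictlyInverseʳ (i , p))

Σ-finite : {A : Set} {P : A → Set} → Finite A → Decidable P → (∀ {a} → Irrelevant (P a)) →
           Finite (Σ A P)
Σ-finite {P = P} (k , A↔Fin) P? P-irr =
  let m , I = Σ-Fin-finite (P? ∘ from) P-irr in m , I ↔-∘ Σ-↔ A↔Fin P↔P∘from∘to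
  where
  open Inverse A↔Fin
  P↔P∘from∘to : ∀ {a} → P a ↔ P (from (to a))
  P↔P∘from∘to {a} = mk↔ₛ′ (subst P (sym (strictlyInverseʳ a))) (subst P (strictlyInverseʳ a))
                          (λ _ → P-irr _ _) (λ _ → P-irr _ _)

proj₁-injective : {A : Set} {P : A → Set} → (∀ {a} → Irrelevant (P a)) →
                  {x y : Σ A P} → proj₁ x ≡ proj₁ y → x ≡ y
proj₁-injective P-irr {a , p} {.a , q} refl = cong (a ,_) (P-irr p q)

-- Rotations of lists

rotate : {A : Set} → ℕ → List A → List A
rotate k xs = drop k xs ++ take k xs

Rot-refl : {A : Set} (xs : List A) → Rot xs xs
Rot-refl xs = 0 , sym (List.++-identityʳ xs)

Rot⇒↭ : {A : Set} {xs ys : List A} → Rot xs ys → ys ↭ xs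
Rot⇒↭ {xs = xs} (k , refl) =
  subst (rotate k xs ↭_) (List.take++drop≡id k xs) (++-comm (drop k xs) (take k xs))

∈-Rot : {A : Set} {xs ys : List A} {z : A} → Rot xs ys → z ∈ ys → z ∈ xs
∈-Rot r = ∈-resp-↭ (Rot⇒↭ r)

rotate-beyond : {A : Set} (k : ℕ) (xs : List A) → length xs ≤ k → rotate k xs ≡ rotate 0 xs
rotate-beyond k xs n≤k = trans (cong₂ _++_ (List.drop-all k xs n≤k) (List.take-all k xs n≤k))
                               (sym (List.++-identityʳ xs))

Rot? : {A : Set} → DecidableEquality A → (xs ys : List A) → Dec (Rot xs ys)
Rot? _≟_ xs ys = map′ bounded⇒Rot Rot⇒bounded
  (ℕ.anyUpTo? (λ k → List.≡-dec _≟_ ys (rotate k xs)) (suc (length xs)))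
  where
  bounded⇒Rot : (∃ λ k → k < suc (length xs) × ys ≡ rotate k xs) → Rot xs ys
  bounded⇒Rot (k , _ , e) = k , e
  Rot⇒bounded : Rot xs ys → ∃ λ k → k < suc (length xs) × ys ≡ rotate k xs
  Rot⇒bounded (k , e) with k ℕ.≤? length xs
  ... | yes k≤n = k , s≤s k≤n , e
  ... | no k≰n = 0 , s≤s z≤n , trans e (rotate-beyond k xs (ℕ.≰⇒≥ k≰n))

map-rotate : {A B : Set} (f : A → B) (k : ℕ) (xs : List A) →
             map f (rotate k xs) ≡ rotate k (map f xs)
map-rotate f k xs = trans (List.map-++ f (drop k xs) (take k xs))
                          (cong₂ _++_ (sym (List.drop-map k xs)) (sym (List.take-map k xs)))

Rot-map⁺ : {A B : Set} (f : A → B) {xs ys : List A} → Rot xs ys → Rot (map f xs) (map f ys)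
Rot-map⁺ f {xs} (k , e) = k , trans (cong (map f) e) (map-rotate f k xs)

Rot-map⁻ : {A B : Set} {f : A → B} → (∀ {x y} → f x ≡ f y → x ≡ y) →
           {xs ys : List A} → Rot (map f xs) (map f ys) → Rot xs ys
Rot-map⁻ {f = f} f-inj {xs} (k , e) =
  k , List.map-injective f-inj (trans e (sym (map-rotate f k xs)))

-- Walks and simple cycles

module Walks (G : Multigraph) where

  _↝_ : Arc G → Arc G → Set
  a ↝ b = tgt G a ≡ src G b

  reach-from-head : ∀ {a as} → Linked _↝_ (a ∷ as) → ∀ {b} → b ∈ a ∷ as →
                    Reach G (src G a) (src G b)
  reach-from-head _ (here refl) = ε
  reach-from-head {a} (a↝ ∷ linked) (there b∈) = (a , refl , a↝) ◅ reach-from-head linked b∈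

  reach-to-last : ∀ as {l} → Linked _↝_ (as ++ [ l ]) → ∀ {b} → b ∈ as →
                  Reach G (src G b) (src G l)
  reach-to-last (a ∷ []) (a↝ ∷ _) (here refl) = (a , refl , a↝) ◅ ε
  reach-to-last (a ∷ a′ ∷ as) (a↝ ∷ linked) (here refl) =
    (a , refl , a↝) ◅ reach-to-last (a′ ∷ as) linked (here refl)
  reach-to-last (a ∷ a′ ∷ as) (_ ∷ linked) (there b∈) = reach-to-last (a′ ∷ as) linked b∈

  tgt-∈-linked : ∀ as {l} → Linked _↝_ (as ++ [ l ]) → ∀ {b} → b ∈ as →
                 tgt G b ∈ verts G as ⊎ tgt G b ≡ src G l
  tgt-∈-linked (a ∷ []) (a↝ ∷ _) (here refl) = inj₂ a↝
  tgt-∈-linked (a ∷ a′ ∷ as) (a↝ ∷ _) (here refl) = inj₁ (there (here a↝))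
  tgt-∈-linked (a ∷ a′ ∷ as) (_ ∷ linked) (there b∈) =
    map₁ there (tgt-∈-linked (a′ ∷ as) linked b∈)

  tgt-∈-verts : (c : SimpleCycle G) → ∀ {b} → b ∈ proj₁ c → tgt G b ∈ verts G (proj₁ c)
  tgt-∈-verts (a ∷ as , linked , _) b∈ = [ id , here ]′ (tgt-∈-linked (a ∷ as) linked b∈)

  cycle-reach : (c : SimpleCycle G) → ∀ {u v} → u ∈ verts G (proj₁ c) → v ∈ verts G (proj₁ c) →
                Reach G u v
  cycle-reach (a ∷ as , linked , _) u∈ v∈ with ∈-map⁻ (src G) u∈ | ∈-map⁻ (src G) v∈
  ... | b , b∈ , refl | b′ , b′∈ , refl =
    reach-to-last (a ∷ as) linked b∈ ◅◅ reach-from-head linked (∈-++⁺ˡ b′∈)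

  Rot⇒ShareVertex : (c d : SimpleCycle G) → Rot (proj₁ c) (proj₁ d) →
                    ShareVertex G (proj₁ c) (proj₁ d)
  Rot⇒ShareVertex c (b ∷ _ , _) rot = src G b , ∈-map⁺ (src G) (∈-Rot rot (here refl)) , here refl

  arcs : ∀ {u v} → Reach G u v → List (Arc G)
  arcs ε = []
  arcs ((a , _) ◅ p) = a ∷ arcs p

  IsPath : ∀ {u v} → Reach G u v → Set
  IsPath {v = v} p = Unique (verts G (arcs p)) × v ∉ verts G (arcs p)

  Path : V G → V G → Set
  Path u v = Σ (Reach G u v) IsPath

  path-suffix : ∀ {u v w} (p : Reach G u v) → IsPath p → w ∈ verts G (arcs p) → Path w v
  path-suffix p@((_ , refl , refl) ◅ _) p-path (here refl) = p , p-path
  path-suffix (_ ◅ p) (_ ∷ unique , v∉) (there w∈) = path-suffix p (unique , v∉ ∘ there) w∈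

  walk⇒path : DecidableEquality (V G) → ∀ {u v} → Reach G u v → Path u v
  walk⇒path _≟_ ε = ε , [] , λ ()
  walk⇒path _≟_ {v = v} ((a , refl , refl) ◅ p) with walk⇒path _≟_ p
  ... | q , q-path with src G a ≟ v
  ...   | yes refl = ε , [] , λ ()
  ...   | no a≢v with Any.any? (src G a ≟_) (verts G (arcs q))
  ...     | yes a∈q = path-suffix q q-path a∈q
  ...     | no a∉q = (a , refl , refl) ◅ q , (¬Any⇒All¬ _ a∉q ∷ proj₁ q-path) ,
                     λ { (here a≡v) → a≢v (sym a≡v) ; (there v∈q) → proj₂ q-path v∈q }

  linked-walk : ∀ {u v} (p : Reach G u v) {a b} → tgt G a ≡ u → src G b ≡ v →
                Linked _↝_ (a ∷ arcs p ++ [ b ])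
  linked-walk ε a↝ ↝b = trans a↝ (sym ↝b) ∷ [-]
  linked-walk ((c , c-src , c-tgt) ◅ p) a↝ ↝b = trans a↝ (sym c-src) ∷ linked-walk p c-tgt ↝b

  close : (a : Arc G) → Path (tgt G a) (src G a) → SimpleCycle G
  close a (p , unique , a∉p) = a ∷ arcs p , linked-walk p refl refl , ¬Any⇒All¬ _ a∉p ∷ unique

-- Induced subgraphs

Induced : (G : Multigraph) → (V G → Set) → Multigraph
Induced G Q = record
  { V   = Σ (V G) Q
  ; Arc = Σ (Arc G) λ a → Q (src G a) × Q (tgt G a)
  ; src = λ { (a , p , _) → src G a , p }
  ; tgt = λ { (a , _ , q) → tgt G a , q }
  }

module InducedCycles (G : Multigraph) {Q : V G → Set} (Q-irr : ∀ {v} → Irrelevant (Q v)) where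

  open Walks G using (_↝_; tgt-∈-verts)

  K : Multigraph
  K = Induced G Q

  lower : List (Arc K) → List (Arc G)
  lower = map proj₁

  private
    arc-irr : ∀ {a} → Irrelevant (Q (src G a) × Q (tgt G a))
    arc-irr (p , q) (p′ , q′) = cong₂ _,_ (Q-irr p p′) (Q-irr q q′)

    verts-lower : ∀ xs → map proj₁ (verts K xs) ≡ verts G (lower xs)
    verts-lower xs = trans (sym (List.map-∘ xs)) (List.map-∘ xs)

    lower-closed : ∀ x xs → lower (x ∷ xs ++ [ x ]) ≡ lower (x ∷ xs) ++ [ proj₁ x ]
    lower-closed x xs = cong (proj₁ x ∷_) (List.map-++ proj₁ xs [ x ])

    ∈-verts-lower⁺ : ∀ {xs w} → w ∈ verts K xs → proj₁ w ∈ verts G (lower xs)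
    ∈-verts-lower⁺ {xs} w∈ = subst (_ ∈_) (verts-lower xs) (∈-map⁺ proj₁ w∈)

    ∈-verts-lower⁻ : ∀ {xs v} → v ∈ verts G (lower xs) → Σ (Q v) λ q → (v , q) ∈ verts K xs
    ∈-verts-lower⁻ {xs} v∈ with ∈-map⁻ proj₁ (subst (_ ∈_) (sym (verts-lower xs)) v∈)
    ... | (_ , q) , w∈ , refl = q , w∈

    IsSimpleCycle-lower⁺ : ∀ xs → IsSimpleCycle K xs → IsSimpleCycle G (lower xs)
    IsSimpleCycle-lower⁺ (x ∷ xs) (linked , unique) =
      subst (Linked _↝_) (lower-closed x xs) (Linked.map⁺ (Linked.map (cong proj₁) linked)) ,
      subst Unique (verts-lower (x ∷ xs)) (Unique.map⁺ (proj₁-injective Q-irr) unique)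

    IsSimpleCycle-lower⁻ : ∀ xs → IsSimpleCycle G (lower xs) → IsSimpleCycle K xs
    IsSimpleCycle-lower⁻ (x ∷ xs) (linked , unique) =
      Linked.map (proj₁-injective Q-irr)
        (Linked.map⁻ (subst (Linked _↝_) (sym (lower-closed x xs)) linked)) ,
      Unique.map⁻ (subst Unique (sym (verts-lower (x ∷ xs))) unique)

    Rot-lower⁺ : ∀ {xs ys} → Rot xs ys → Rot (lower xs) (lower ys)
    Rot-lower⁺ = Rot-map⁺ proj₁

    Rot-lower⁻ : ∀ {xs ys} → Rot (lower xs) (lower ys) → Rot xs ys
    Rot-lower⁻ = Rot-map⁻ (proj₁-injective arc-irr)

    ShareVertex-lower⁺ : ∀ {xs ys} → ShareVertex K xs ys → ShareVertex G (lower xs) (lower ys)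
    ShareVertex-lower⁺ (w , w∈xs , w∈ys) = proj₁ w , ∈-verts-lower⁺ w∈xs , ∈-verts-lower⁺ w∈ys

    ShareVertex-lower⁻ : ∀ {xs ys} → ShareVertex G (lower xs) (lower ys) → ShareVertex K xs ys
    ShareVertex-lower⁻ {ys = ys} (v , v∈xs , v∈ys) with ∈-verts-lower⁻ v∈xs | ∈-verts-lower⁻ v∈ys
    ... | q , w∈xs | q′ , w∈ys =
      (v , q) , w∈xs , subst (λ q → (v , q) ∈ verts K ys) (Q-irr q′ q) w∈ys

  Induced-finite : IsFinite G → Decidable Q → IsFinite K
  Induced-finite (V-finite , Arc-finite) Q? =
    Σ-finite V-finite Q? Q-irr , Σ-finite Arc-finite (λ a → Q? (src G a) ×-dec Q? (tgt G a)) arc-irr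

  lowerCycle : SimpleCycle K → SimpleCycle G
  lowerCycle (xs , cycle) = lower xs , IsSimpleCycle-lower⁺ xs cycle

  OnQ : SimpleCycle G → Set
  OnQ c = ∀ {v} → v ∈ verts G (proj₁ c) → Q v

  private
    liftArcs : (as : List (Arc G)) → (∀ {b} → b ∈ as → Q (src G b) × Q (tgt G b)) → List (Arc K)
    liftArcs [] _ = []
    liftArcs (a ∷ as) inQ = (a , inQ (here refl)) ∷ liftArcs as (inQ ∘ there)

    lower-liftArcs : ∀ as (inQ : ∀ {b} → b ∈ as → Q (src G b) × Q (tgt G b)) →
                     lower (liftArcs as inQ) ≡ as
    lower-liftArcs [] _ = refl
    lower-liftArcs (a ∷ as) inQ = cong (a ∷_) (lower-liftArcs as (inQ ∘ there))

    arcs-onQ : (c : SimpleCycle G) → OnQ c → ∀ {b} → b ∈ proj₁ c → Q (src G b) × Q (tgt G b)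
    arcs-onQ c onQ b∈ = onQ (∈-map⁺ (src G) b∈) , onQ (tgt-∈-verts c b∈)

  liftCycle : (c : SimpleCycle G) → OnQ c → SimpleCycle K
  liftCycle c@(as , cycle) onQ =
    xs , IsSimpleCycle-lower⁻ xs (subst (IsSimpleCycle G) (sym lower-xs) cycle)
    where
    xs : List (Arc K)
    xs = liftArcs as (arcs-onQ c onQ)
    lower-xs : lower xs ≡ as
    lower-xs = lower-liftArcs as (arcs-onQ c onQ)

  lower-liftCycle : ∀ c (onQ : OnQ c) → lower (proj₁ (liftCycle c onQ)) ≡ proj₁ c
  lower-liftCycle c onQ = lower-liftArcs (proj₁ c) (arcs-onQ c onQ)

  ∈-verts-lift : ∀ c (onQ : OnQ c) {v} (q : Q v) → v ∈ verts G (proj₁ c) →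
                 (v , q) ∈ verts K (proj₁ (liftCycle c onQ))
  ∈-verts-lift c onQ {v} q v∈
    with ∈-verts-lower⁻ (subst (λ as → v ∈ verts G as) (sym (lower-liftCycle c onQ)) v∈)
  ... | q′ , w∈ = subst (λ q → (v , q) ∈ verts K _) (Q-irr q′ q) w∈

  module LiftedPair (c d : SimpleCycle G) (onQc : OnQ c) (onQd : OnQ d) where
    private
      c↑ d↑ : SimpleCycle K
      c↑ = liftCycle c onQc
      d↑ = liftCycle d onQd
      ↓c↑ : lower (proj₁ c↑) ≡ proj₁ c
      ↓c↑ = lower-liftCycle c onQc
      ↓d↑ : lower (proj₁ d↑) ≡ proj₁ d
      ↓d↑ = lower-liftCycle d onQd

    Rot-lift⁺ : Rot (proj₁ c) (proj₁ d) → Rot (proj₁ c↑) (proj₁ d↑)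
    Rot-lift⁺ r = Rot-lower⁻ (subst₂ Rot (sym ↓c↑) (sym ↓d↑) r)

    Rot-lift⁻ : Rot (proj₁ c↑) (proj₁ d↑) → Rot (proj₁ c) (proj₁ d)
    Rot-lift⁻ r = subst₂ Rot ↓c↑ ↓d↑ (Rot-lower⁺ r)

    Adj-lift⁺ : Adj (φ G) c d → Adj (φ K) c↑ d↑
    Adj-lift⁺ (¬rot , share) =
      ¬rot ∘ Rot-lift⁻ , ShareVertex-lower⁻ (subst₂ (ShareVertex G) (sym ↓c↑) (sym ↓d↑) share)

    Adj-lift⁻ : Adj (φ K) c↑ d↑ → Adj (φ G) c d
    Adj-lift⁻ (¬rot , share) =
      ¬rot ∘ Rot-lift⁺ , subst₂ (ShareVertex G) ↓c↑ ↓d↑ (ShareVertex-lower⁺ share)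

  Rot-lift-lower : (c : SimpleCycle G) (onQ : OnQ c) (D : SimpleCycle K) →
                   Rot (proj₁ c) (lower (proj₁ D)) → Rot (proj₁ (liftCycle c onQ)) (proj₁ D)
  Rot-lift-lower c onQ D r = Rot-lower⁻ (subst (λ xs → Rot xs _) (sym (lower-liftCycle c onQ)) r)

φ-Step : (G : Multigraph) → SimpleCycle G → SimpleCycle G → Set
φ-Step G c d = _≈_ (φ G) c d ⊎ Adj (φ G) c d

sharing⇒φ-Step : (G : Multigraph) → DecidableEquality (Arc G) → (c d : SimpleCycle G) →
                 ∀ {v} → v ∈ verts G (proj₁ c) → v ∈ verts G (proj₁ d) → φ-Step G c d
sharing⇒φ-Step G _≟_ c d v∈c v∈d with Rot? _≟_ (proj₁ c) (proj₁ d)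
... | yes rot = inj₁ rot
... | no ¬rot = inj₂ (¬rot , _ , v∈c , v∈d)

φ-connected : (G : Multigraph) → IsFinite G → StronglyConnected G → Connected (φ G)
φ-connected G (V-finite , Arc-finite) strong c@(a ∷ _ , _) d@(b ∷ _ , _) =
  along (strong (src G a) (src G b)) c (here refl) (here refl)
  where
  open Walks G

  cycle-through : (a : Arc G) → SimpleCycle G
  cycle-through a = close a (walk⇒path (finite⇒≟ V-finite) (strong (tgt G a) (src G a)))

  step : (c c′ : SimpleCycle G) → ∀ {v} → v ∈ verts G (proj₁ c) → v ∈ verts G (proj₁ c′) →
         φ-Step G c c′
  step = sharing⇒φ-Step G (finite⇒≟ Arc-finite)

  along : ∀ {u w} → Reach G u w → (c : SimpleCycle G) → u ∈ verts G (proj₁ c) →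
          w ∈ verts G (proj₁ d) → Star (φ-Step G) c d
  along ε c u∈c u∈d = step c d u∈c u∈d ◅ ε
  along ((a , refl , refl) ◅ p) c a∈c w∈d =
    step c (cycle-through a) a∈c (here refl) ◅
    along p (cycle-through a) (tgt-∈-verts (cycle-through a) (here refl)) w∈d

module SCCDecomposition (G : Multigraph) {n : ℕ} (comp : V G → Fin n)
                        (scc : IsSCCLabelling G n comp) where

  open Walks G using (cycle-reach; Rot⇒ShareVertex)
  -- Component G comp i is, definitionally, Induced G (λ v → comp v ≡ i).
  module C (i : Fin n) = InducedCycles G {λ v → comp v ≡ i} uip

  Φ : Fin n → SGraph
  Φ i = φ (Component G comp i)

  component : SimpleCycle G → Fin n
  component (a ∷ _ , _) = comp (src G a)

  comp-on-cycle : (c : SimpleCycle G) → ∀ {v} → v ∈ verts G (proj₁ c) → comp v ≡ component c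
  comp-on-cycle c@(_ ∷ _ , _) v∈ =
    Equivalence.from (proj₂ scc _ _) (cycle-reach c v∈ (here refl) , cycle-reach c (here refl) v∈)

  component-shared : ∀ c d → ShareVertex G (proj₁ c) (proj₁ d) → component c ≡ component d
  component-shared c d (_ , v∈c , v∈d) = trans (sym (comp-on-cycle c v∈c)) (comp-on-cycle d v∈d)

  restrict : SimpleCycle G → Vt (⨆ Φ)
  restrict c = component c , C.liftCycle (component c) c (comp-on-cycle c)

  module _ {i j} (c d : SimpleCycle G) (onc : C.OnQ i c) (ond : C.OnQ j d) where

    ⨆-≈-lift : i ≡ j → Rot (proj₁ c) (proj₁ d) →
               ⊔≈ Φ (i , C.liftCycle i c onc) (j , C.liftCycle j d ond)
    ⨆-≈-lift refl rot = inj≈ (C.LiftedPair.Rot-lift⁺ i c d onc ond rot)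

    ⨆-≈-lift⁻ : ⊔≈ Φ (i , C.liftCycle i c onc) (j , C.liftCycle j d ond) →
                Rot (proj₁ c) (proj₁ d)
    ⨆-≈-lift⁻ (inj≈ rot) = C.LiftedPair.Rot-lift⁻ i c d onc ond rot

    ⨆-Adj-lift : i ≡ j → Adj (φ G) c d →
                 ⊔Adj Φ (i , C.liftCycle i c onc) (j , C.liftCycle j d ond)
    ⨆-Adj-lift refl adj = injAdj (C.LiftedPair.Adj-lift⁺ i c d onc ond adj)

    ⨆-Adj-lift⁻ : ⊔Adj Φ (i , C.liftCycle i c onc) (j , C.liftCycle j d ond) →
                  Adj (φ G) c d
    ⨆-Adj-lift⁻ (injAdj adj) = C.LiftedPair.Adj-lift⁻ i c d onc ond adj

  ⨆-≈-lift-lower : ∀ {i j} (D : SimpleCycle (Component G comp j))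
                   (onQ : C.OnQ i (C.lowerCycle j D)) → i ≡ j →
                   ⊔≈ Φ (i , C.liftCycle i (C.lowerCycle j D) onQ) (j , D)
  ⨆-≈-lift-lower {i} D onQ refl = inj≈ (C.Rot-lift-lower i (C.lowerCycle i D) onQ D (Rot-refl _))

  φ≅⨆ : φ G ≅ ⨆ Φ
  φ≅⨆ = record { f = restrict ; resp = resp ; inj = inj ; surj = surj ; adj = adj }
    where
    resp : ∀ c d → Rot (proj₁ c) (proj₁ d) → ⊔≈ Φ (restrict c) (restrict d)
    resp c d rot = ⨆-≈-lift c d (comp-on-cycle c) (comp-on-cycle d)
                     (component-shared c d (Rot⇒ShareVertex c d rot)) rot

    inj : ∀ c d → ⊔≈ Φ (restrict c) (restrict d) → Rot (proj₁ c) (proj₁ d)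
    inj c d = ⨆-≈-lift⁻ c d (comp-on-cycle c) (comp-on-cycle d)

    surj : ∀ D → ∃ λ c → ⊔≈ Φ (restrict c) D
    surj (i , D@((_ , comp≡i , _) ∷ _ , _)) =
      C.lowerCycle i D , ⨆-≈-lift-lower D (comp-on-cycle (C.lowerCycle i D)) comp≡i

    adj : ∀ c d → Adj (φ G) c d ⇔ ⊔Adj Φ (restrict c) (restrict d)
    adj c d = mk⇔ (λ adj → ⨆-Adj-lift c d onc ond (component-shared c d (proj₂ adj)) adj)
                  (⨆-Adj-lift⁻ c d onc ond)
      where
      onc : C.OnQ (component c) c
      onc = comp-on-cycle c
      ond : C.OnQ (component d) d
      ond = comp-on-cycle d

module CoveredSubgraph (H : SimpleGraph) (H-connected : Connected (toSGraph H))
                       (G : Multigraph) (G-finite : IsFinite G) (ι : Realizes G H) where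

  open _≅_ ι renaming (f to cycleOf)

  covered? : (v : V G) → Dec (∃ λ j → v ∈ verts G (proj₁ (cycleOf j)))
  covered? v = Fin.any? λ j →
    Any.any? (finite⇒≟ (proj₁ G-finite) v) (verts G (proj₁ (cycleOf j)))

  Covered : V G → Set
  Covered v = True (covered? v)

  open InducedCycles G {Covered} T-irrelevant

  cycle-covered : ∀ j → OnQ (cycleOf j)
  cycle-covered j v∈ = fromWitness (j , v∈)

  cycle↑ : Fin (size H) → SimpleCycle K
  cycle↑ j = liftCycle (cycleOf j) (cycle-covered j)

  K-finite : IsFinite K
  K-finite = Induced-finite G-finite (λ v → T? _)

  module Pair (j j′ : Fin (size H)) =
    LiftedPair (cycleOf j) (cycleOf j′) (cycle-covered j) (cycle-covered j′)

  realizes : Realizes K H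
  realizes = record { f = cycle↑ ; resp = resp↑ ; inj = inj↑ ; surj = surj↑ ; adj = adj↑ }
    where
    resp↑ : ∀ j j′ → j ≡ j′ → Rot (proj₁ (cycle↑ j)) (proj₁ (cycle↑ j′))
    resp↑ j _ refl = Rot-refl (proj₁ (cycle↑ j))

    inj↑ : ∀ j j′ → Rot (proj₁ (cycle↑ j)) (proj₁ (cycle↑ j′)) → j ≡ j′
    inj↑ j j′ = inj j j′ ∘ Pair.Rot-lift⁻ j j′

    adj↑ : ∀ j j′ → E H j j′ ⇔ Adj (φ K) (cycle↑ j) (cycle↑ j′)
    adj↑ j j′ = mk⇔ (Pair.Adj-lift⁺ j j′ ∘ Equivalence.to (adj j j′))
                    (Equivalence.from (adj j j′) ∘ Pair.Adj-lift⁻ j j′)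

    surj↑ : ∀ D → ∃ λ j → Rot (proj₁ (cycle↑ j)) (proj₁ D)
    surj↑ D with surj (lowerCycle D)
    ... | j , rot = j , Rot-lift-lower (cycleOf j) (cycle-covered j) D rot

  K-strongly-connected : StronglyConnected K
  K-strongly-connected (u , u-cov) (v , v-cov) with toWitness u-cov | toWitness v-cov
  ... | j , u∈ | j′ , v∈ =
    walk (H-connected j j′) (∈-verts-lift (cycleOf j) (cycle-covered j) u-cov u∈)
         (∈-verts-lift (cycleOf j′) (cycle-covered j′) v-cov v∈)
    where
    walk : ∀ {j j′ x y} → Star (λ i i′ → i ≡ i′ ⊎ E H i i′) j j′ →
           x ∈ verts K (proj₁ (cycle↑ j)) → y ∈ verts K (proj₁ (cycle↑ j′)) → Reach K x y
    walk {j} ε x∈ y∈ = Walks.cycle-reach K (cycle↑ j) x∈ y∈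
    walk (inj₁ refl ◅ path) x∈ y∈ = walk path x∈ y∈
    walk {j} (inj₂ edge ◅ path) x∈ y∈ with proj₂ (Equivalence.to (_≅_.adj realizes _ _) edge)
    ... | w , w∈ , w∈′ = Walks.cycle-reach K (cycle↑ j) x∈ w∈ ◅◅ walk path w∈′ y∈

  strongly-connected-realization :
    Σ Multigraph λ K → IsFinite K × StronglyConnected K × Realizes K H
  strongly-connected-realization = K , K-finite , K-strongly-connected , realizes

proposition1 :
    ((G : Multigraph) → IsFinite G → StronglyConnected G → Connected (φ G))
    × ((G : Multigraph) → IsFinite G → (n : ℕ) (comp : V G → Fin n) →
         IsSCCLabelling G n comp → φ G ≅ ⨆ (λ i → φ (Component G comp i)))
    × ((H : SimpleGraph) → Connected (toSGraph H) → Realizable H →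
         Σ Multigraph (λ G → IsFinite G × StronglyConnected G × Realizes G H))
proposition1 =
  φ-connected ,
  (λ G _ _ comp scc → SCCDecomposition.φ≅⨆ G comp scc) ,
  λ H H-connected (G , G-finite , ι) →
    CoveredSubgraph.strongly-connected-realization H H-connected G G-finite ι
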